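{- Let $d\ge 1$, let $g:\mathbb{N}\to\mathbb{N}$ be monotone and expansive, and let $n_0\in\mathbb{N}$. If every order ideal in the canonical decomposition of a downwards-closed set $D\subseteq\mathbb{N}^d$ is thin, then every $\sqsubseteq$-minimal element $v$ of $\mathbb{N}^d\setminus D$ is nearly thin.
   Context: $\mathbb{N}^d$ is ordered componentwise by $\sqsubseteq$; downwards-closed sets are sets $D$ with $x\in D$, $y\sqsubseteq x\Rightarrow y\in D$. With $\mathbb{N}_\omega=\mathbb{N}\cup\{\omega\}$, the order ideals of $\mathbb{N}^d$ (non-empty directed downwards-closed sets) are the sets $\{x\in\mathbb{N}^d: x\sqsubseteq v\}$, $v\in\mathbb{N}_\omega^d$, identified with $v$. For an ideal $I$: $\mathrm{fin}(I)=\{i: I(i)<\omega\}$ and $\operatorname{fdim}I=|\mathrm{fin}(I)|$. Each downwards-closed $D$ is uniquely a finite union of pairwise inclusion-incomparable ideals (its canonical decomposition). Define $N_0=n_0$, $L_0=0$, and for $0\le i<d$: $N_{i+1}=g^{L_i+1}(n_0)$, $L_{i+1}=L_i+\prod_{1\le j\le i+1}(d-j+1)(N_j+1)$, where $g^k$ is the $k$-th iterate of $g$. An ideal $I$ is thin if there is a bijection $\sigma:\mathrm{fin}(I)\to\{1,\dots,\operatorname{fdim}I\}$ with $I(i)\le N_{\sigma(i)}$ for all $i\in\mathrm{fin}(I)$. A vector $v\in\mathbb{N}^d$ is nearly thin if there is a permutation $\sigma$ of $\{1,\dots,d\}$ with $v(i)\le N_{\sigma(i)}+1$ for all $1\le i\le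 d$. -}

module Defs where

open import Data.Nat using (ℕ; zero; suc; _+_; _*_; _∸_; _≤_)
open import Data.Fin using (Fin; toℕ)
open import Data.Fin.Permutation using (Permutation′; _⟨$⟩ʳ_)
open import Data.Product using (Σ; _×_; _,_; proj₁; proj₂)
open import Data.Unit using (⊤)
open import Data.Empty using (⊥)
open import Data.List using (List)
open import Data.List.Relation.Unary.Any using (Any)
open import Data.List.Relation.Unary.All using (All)
open import Data.List.Relation.Unary.AllPairs using (AllPairs)
open import Relation.Nullary using (¬_)
open import Relation.Binary.PropositionalEquality using (_≡_)
open import Function.Bundles using (_⤖_; _⇔_; Bijection)

data ℕω : Set where
  fin : ℕ → ℕω
  ω   : ℕω

_≤ω_ : ℕ → ℕω → Set
n ≤ω fin m = n ≤ m
n ≤ω ω     = ⊤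

Vecℕ : ℕ → Set
Vecℕ d = Fin d → ℕ

_⊑_ : {d : ℕ} → Vecℕ d → Vecℕ d → Set
x ⊑ y = ∀ i → x i ≤ y i

DownClosed : {d : ℕ} → (Vecℕ d → Set) → Set
DownClosed {d} D = ∀ (x y : Vecℕ d) → D x → y ⊑ x → D y

-- ideals of ℕ^d, identified with vectors of ℕ_ω^d
Ideal : ℕ → Set
Ideal d = Fin d → ℕω

_∈I_ : {d : ℕ} → Vecℕ d → Ideal d → Set
x ∈I I = ∀ i → x i ≤ω I i

_⊆I_ : {d : ℕ} → Ideal d → Ideal d → Set
_⊆I_ {d} I J = ∀ (x : Vecℕ d) → x ∈I I → x ∈I J

IsCanonicalDecomposition : {d : ℕ} → (Vecℕ d → Set) → List (Ideal d) → Set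
IsCanonicalDecomposition {d} D Is =
  (∀ (x : Vecℕ d) → D x ⇔ Any (x ∈I_) Is)
  × AllPairs (λ I J → ¬ (I ⊆I J) × ¬ (J ⊆I I)) Is

FinIdx : {d : ℕ} → Ideal d → Set
FinIdx {d} I = Σ (Fin d) λ i → Σ ℕ λ n → I i ≡ fin n

isFinℕ : ℕω → ℕ
isFinℕ (fin _) = 1
isFinℕ ω       = 0

fdim : {d : ℕ} → Ideal d → ℕ
fdim {zero}  I = 0
fdim {suc d} I = isFinℕ (I Fin.zero) + fdim {d} (λ i → I (Fin.suc i))

iter : (ℕ → ℕ) → ℕ → ℕ → ℕ
iter g zero    x = x
iter g (suc k) x = g (iter g k x)

record NLP : Set where
  constructor nlp
  field
    Nv : ℕ
    Lv : ℕ
    Pv : ℕ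

NL : (g : ℕ → ℕ) (n₀ d : ℕ) → ℕ → NLP
NL g n₀ d zero    = nlp n₀ 0 1
NL g n₀ d (suc i) =
  let L  = NLP.Lv (NL g n₀ d i)
      P  = NLP.Pv (NL g n₀ d i)
      N' = iter g (suc L) n₀
      P' = P * ((d ∸ suc i + 1) * (N' + 1))
  in nlp N' (L + P') P'

Nseq : (g : ℕ → ℕ) (n₀ d : ℕ) → ℕ → ℕ
Nseq g n₀ d i = NLP.Nv (NL g n₀ d i)

Lseq : (g : ℕ → ℕ) (n₀ d : ℕ) → ℕ → ℕ
Lseq g n₀ d i = NLP.Lv (NL g n₀ d i)

-- thin ideals: a bijection σ : fin(I) → {1,…,fdim I} (encoded as Fin (fdim I),
-- element k standing for k+1) with I(i) ≤ N_{σ(i)}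
Thin : (g : ℕ → ℕ) (n₀ : ℕ) {d : ℕ} → Ideal d → Set
Thin g n₀ {d} I =
  Σ (FinIdx I ⤖ Fin (fdim I)) λ σ →
    ∀ (p : FinIdx I) →
      proj₁ (proj₂ p) ≤ Nseq g n₀ d (suc (toℕ (Bijection.to σ p)))

-- nearly thin vectors: a permutation σ of {1,…,d} (encoded on Fin d,
-- element k standing for k+1) with v(i) ≤ N_{σ(i)} + 1
NearlyThin : (g : ℕ → ℕ) (n₀ : ℕ) {d : ℕ} → Vecℕ d → Set
NearlyThin g n₀ {d} v =
  Σ (Permutation′ d) λ σ →
    ∀ (i : Fin d) → v i ≤ Nseq g n₀ d (suc (toℕ (σ ⟨$⟩ʳ i))) + 1

Monotone : (ℕ → ℕ) → Set
Monotone g = ∀ {x y} → x ≤ y → g x ≤ g y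

Expansive : (ℕ → ℕ) → Set
Expansive g = ∀ x → x ≤ g x

MinimalOutside : {d : ℕ} → (Vecℕ d → Set) → Vecℕ d → Set
MinimalOutside {d} D v =
  ¬ D v × (∀ (w : Vecℕ d) → ¬ D w → w ⊑ v → v ⊑ w)

-- Say v is minimal outside D and some a+1 coordinates of v exceed N_{k+1} + 1, where
-- a + k + 1 = d. Lowering one of them by 1 gives a vector w below v, hence in D, hence in
-- some thin ideal I of the decomposition. As v ∉ I, the lowered coordinate is finite in I
-- and above N_{k+1}; since N is non-decreasing its σ-value exceeds k+1, so the k+1
-- coordinates with σ-values 1, …, k+1 are finite in I and bounded by N_{k+1}. These are
-- disjoint from the a+1 large coordinates of w, giving a+k+2 > d coordinates. So for every
-- k < d fewer than d−k coordinates of v exceed N_{k+1} + 1, which is exactly what is needed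
-- to match the coordinates of v with the bounds N_1 + 1, …, N_d + 1.
module Submission where

open import Defs
open import Data.Nat using (ℕ; zero; suc; _+_; _≤_; _<_; _≤′_; ≤′-refl; ≤′-step; pred; z≤n; s≤s)
open import Data.Nat.Properties
open import Data.Fin using (Fin; toℕ; fromℕ; punchIn; punchOut; inject≤; splitAt; join)
  renaming (zero to fzero; suc to fsuc)
open import Data.Fin.Properties
  using (toℕ<n; toℕ-fromℕ; toℕ-inject≤; inject≤-injective; punchIn-punchOut; punchIn-injective;
         punchInᵢ≢i; injective⇒≤; join-splitAt; all?)
  renaming (_≟_ to _≟F_)
open import Data.Fin.Permutation using (Permutation′; _⟨$⟩ʳ_; insert; insert-punchIn)
import Data.Fin.Permutation as Permutation
open import Data.Vec.Functional using (updateAt)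
open import Data.Vec.Functional.Properties using (updateAt-updates; updateAt-minimal)
open import Data.Product using (Σ; _×_; _,_; proj₁; proj₂)
open import Data.Sum using (inj₁; inj₂; [_,_]′)
open import Data.Unit using (tt)
open import Data.Empty using (⊥-elim)
open import Data.List using (List)
open import Data.List.Membership.Propositional using (_∈_; find; lose)
open import Data.List.Relation.Unary.Any using (Any; any?)
open import Data.List.Relation.Unary.All using (All)
import Data.List.Relation.Unary.All as All
open import Relation.Nullary using (¬_; yes; no; Dec; contradiction)
open import Relation.Binary.PropositionalEquality
open import Function.Base using (_∘_)
open import Function.Definitions using (Injective)
open import Function.Bundles using (_⇔_; Bijection; Surjection; Equivalence)

≤-suc⇒mono : ∀ (f : ℕ → ℕ) → (∀ i → f i ≤ f (suc i)) → ∀ {i j} → i ≤ j → f i ≤ f j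
≤-suc⇒mono f step i≤j = go (≤⇒≤′ i≤j)
  where
  go : ∀ {i j} → i ≤′ j → f i ≤ f j
  go ≤′-refl                   = ≤-refl
  go {j = suc j} (≤′-step i≤j) = ≤-trans (go i≤j) (step j)

module _ {g : ℕ → ℕ} (g-expansive : Expansive g) (n₀ d : ℕ) where

  Nseq-≤-suc : ∀ i → Nseq g n₀ d i ≤ Nseq g n₀ d (suc i)
  Nseq-≤-suc zero    = g-expansive n₀
  Nseq-≤-suc (suc i) =
    ≤-suc⇒mono (λ k → iter g k n₀) (λ k → g-expansive _) (s≤s (m≤m+n L P))
    where
    L P : ℕ
    L = Lseq g n₀ d i
    P = NLP.Pv (NL g n₀ d (suc i))

  Nseq-mono : ∀ {i j} → i ≤ j → Nseq g n₀ d i ≤ Nseq g n₀ d j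
  Nseq-mono = ≤-suc⇒mono (Nseq g n₀ d) Nseq-≤-suc

[,]-injective : ∀ {m k n} {f : Fin m → Fin n} {h : Fin k → Fin n} →
  Injective _≡_ _≡_ f → Injective _≡_ _≡_ h → (∀ x y → f x ≢ h y) →
  Injective _≡_ _≡_ [ f , h ]′
[,]-injective f-inj h-inj disjoint {inj₁ x} {inj₁ x′} eq = cong inj₁ (f-inj eq)
[,]-injective f-inj h-inj disjoint {inj₁ x} {inj₂ y′} eq = contradiction eq (disjoint x y′)
[,]-injective f-inj h-inj disjoint {inj₂ y} {inj₁ x′} eq = contradiction (sym eq) (disjoint x′ y)
[,]-injective f-inj h-inj disjoint {inj₂ y} {inj₂ y′} eq = cong inj₂ (h-inj eq)

disjoint-injections⇒+≤ : ∀ {m k n} {f : Fin m → Fin n} {h : Fin k → Fin n} →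
  Injective _≡_ _≡_ f → Injective _≡_ _≡_ h → (∀ x y → f x ≢ h y) → m + k ≤ n
disjoint-injections⇒+≤ {m} {k} {f = f} {h} f-inj h-inj disjoint =
  injective⇒≤ {f = [ f , h ]′ ∘ splitAt m} (λ {z} {z′} eq → begin
    z                        ≡⟨ join-splitAt m k z ⟨
    join m k (splitAt m z)   ≡⟨ cong (join m k) (split-injective eq) ⟩
    join m k (splitAt m z′)  ≡⟨ join-splitAt m k z′ ⟩
    z′                       ∎)
  where
  open ≡-Reasoning
  split-injective : ∀ {z z′} → [ f , h ]′ (splitAt m z) ≡ [ f , h ]′ (splitAt m z′) →
    splitAt m z ≡ splitAt m z′
  split-injective {z} {z′} = [,]-injective f-inj h-inj disjoint {splitAt m z} {splitAt m z′}

argmax : ∀ {n} (v : Fin (suc n) → ℕ) → Σ (Fin (suc n)) λ m → ∀ j → v j ≤ v m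
argmax {zero}  v = fzero , λ { fzero → ≤-refl }
argmax {suc n} v with argmax (λ j → v (fsuc j))
... | m , m-max with v fzero ≤? v (fsuc m)
...   | yes v₀≤ = fsuc m , λ { fzero → v₀≤ ; (fsuc j) → m-max j }
...   | no  v₀≰ = fzero , λ { fzero → ≤-refl ; (fsuc j) → ≤-trans (m-max j) (<⇒≤ (≰⇒> v₀≰)) }

FewerThanAbove : ∀ {d} → ℕ → ℕ → (Fin d → ℕ) → Set
FewerThanAbove {d} a b v =
  (f : Fin a → Fin d) → Injective _≡_ _≡_ f → ¬ (∀ x → b < v (f x))

fewerThanAbove-punchIn : ∀ {d a b} {v : Fin (suc d) → ℕ} (m : Fin (suc d)) →
  (∀ j → v j ≤ v m) → FewerThanAbove (suc (suc a)) b v →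
  FewerThanAbove (suc a) b (λ j → v (punchIn m j))
fewerThanAbove-punchIn {d} {a} {b} {v} m m-max fewer f f-inj above = fewer f′ f′-inj above′
  where
  f′ : Fin (suc (suc a)) → Fin (suc d)
  f′ fzero    = m
  f′ (fsuc x) = punchIn m (f x)
  f′-inj : Injective _≡_ _≡_ f′
  f′-inj {fzero}  {fzero}  _  = refl
  f′-inj {fzero}  {fsuc y} eq = ⊥-elim (punchInᵢ≢i m (f y) (sym eq))
  f′-inj {fsuc x} {fzero}  eq = ⊥-elim (punchInᵢ≢i m (f x) eq)
  f′-inj {fsuc x} {fsuc y} eq = cong fsuc (f-inj (punchIn-injective m _ _ eq))
  above′ : ∀ x → b < v (f′ x)
  above′ fzero    = <-≤-trans (above fzero) (m-max _)
  above′ (fsuc x) = above x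

toℕ-punchIn-fromℕ : ∀ {n} (x : Fin n) → toℕ (punchIn (fromℕ n) x) ≡ toℕ x
toℕ-punchIn-fromℕ fzero    = refl
toℕ-punchIn-fromℕ (fsuc x) = cong suc (toℕ-punchIn-fromℕ x)

insert-lookup : ∀ {m} (i : Fin (suc m)) j (π : Permutation′ m) → insert i j π ⟨$⟩ʳ i ≡ j
insert-lookup i j π with i ≟F i
... | yes _  = refl
... | no i≢i = contradiction refl i≢i

-- Greedy matching: by the hypothesis for k = d − 1 a largest coordinate is at most t d, so
-- it is sent to d and the remaining coordinates are matched recursively with t 1, …, t (d − 1).
fewerThanAbove⇒permutation : ∀ d (t : ℕ → ℕ) (v : Fin d → ℕ) →
  (∀ a k → a + suc k ≡ d → FewerThanAbove (suc a) (t (suc k)) v) →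
  Σ (Permutation′ d) λ σ → ∀ i → v i ≤ t (suc (toℕ (σ ⟨$⟩ʳ i)))
fewerThanAbove⇒permutation zero    t v fewer = Permutation.id , λ ()
fewerThanAbove⇒permutation (suc d) t v fewer = σ , bounded
  where
  m : Fin (suc d)
  m = proj₁ (argmax v)
  m-max : ∀ j → v j ≤ v m
  m-max = proj₂ (argmax v)
  vₘ≤ : v m ≤ t (suc d)
  vₘ≤ = ≮⇒≥ (λ t<vₘ → fewer 0 d refl (λ _ → m) (λ { {fzero} {fzero} _ → refl }) (λ _ → t<vₘ))
  rest : Σ (Permutation′ d) λ π → ∀ j → v (punchIn m j) ≤ t (suc (toℕ (π ⟨$⟩ʳ j)))
  rest = fewerThanAbove⇒permutation d t (λ j → v (punchIn m j))
    (λ a k eq → fewerThanAbove-punchIn m m-max (fewer (suc a) k (cong suc eq)))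
  π : Permutation′ d
  π = proj₁ rest
  σ : Permutation′ (suc d)
  σ = insert m (fromℕ d) π
  bounded′ : ∀ i → Dec (m ≡ i) → v i ≤ t (suc (toℕ (σ ⟨$⟩ʳ i)))
  bounded′ i (yes refl) = subst (λ z → v m ≤ t (suc z))
    (sym (trans (cong toℕ (insert-lookup m (fromℕ d) π)) (toℕ-fromℕ d))) vₘ≤
  bounded′ i (no m≢i) = subst (λ z → v z ≤ t (suc (toℕ (σ ⟨$⟩ʳ z)))) (punchIn-punchOut m≢i)
    (subst (λ z → v (punchIn m j) ≤ t (suc z))
      (sym (trans (cong toℕ (insert-punchIn m (fromℕ d) π j)) (toℕ-punchIn-fromℕ (π ⟨$⟩ʳ j))))
      (proj₂ rest j))
    where
    j : Fin d
    j = punchOut m≢i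
  bounded : ∀ i → v i ≤ t (suc (toℕ (σ ⟨$⟩ʳ i)))
  bounded i = bounded′ i (m ≟F i)

_≤ω?_ : ∀ n a → Dec (n ≤ω a)
n ≤ω? fin m = n ≤? m
n ≤ω? ω     = yes tt

_∈I?_ : ∀ {d} (x : Vecℕ d) (I : Ideal d) → Dec (x ∈I I)
x ∈I? I = all? (λ i → x i ≤ω? I i)

∈I-fin : ∀ {d} {x : Vecℕ d} {I : Ideal d} {i n} → x ∈I I → I i ≡ fin n → x i ≤ n
∈I-fin {x = x} {i = i} x∈I Iᵢ≡n = subst (x i ≤ω_) Iᵢ≡n (x∈I i)

fin-witness-unique : ∀ {a : ℕω} {n m} (a≡n : a ≡ fin n) (a≡m : a ≡ fin m) →
  _≡_ {A = Σ ℕ λ k → a ≡ fin k} (n , a≡n) (m , a≡m)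
fin-witness-unique refl refl = refl

FinIdx-≡ : ∀ {d} {I : Ideal d} {p q : FinIdx I} → proj₁ p ≡ proj₁ q → p ≡ q
FinIdx-≡ {p = i , n , Iᵢ≡n} {.i , m , Iᵢ≡m} refl = cong (i ,_) (fin-witness-unique Iᵢ≡n Iᵢ≡m)

module _ {g : ℕ → ℕ} (g-expansive : Expansive g) {n₀ d : ℕ} where

  private
    N : ℕ → ℕ
    N = Nseq g n₀ d

  -- The coordinates with σ-values 1, …, k.
  thin⇒bounded-coordinates : ∀ {I : Ideal d} → Thin g n₀ I → ∀ {i n} k →
    I i ≡ fin n → N k < n →
    Σ (Fin k → Fin d) λ r → Injective _≡_ _≡_ r × (∀ y x → x ∈I I → x (r y) ≤ N k)
  thin⇒bounded-coordinates {I} (σ , σ-bounded) {i} {n} k Iᵢ≡n Nₖ<n = r , r-injective , r-bounded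
    where
    open Bijection σ using (to; surjection)
    open Surjection surjection using (to⁻; to∘to⁻)
    s : ℕ
    s = toℕ (to (i , n , Iᵢ≡n))
    k≤s : k ≤ s
    k≤s = ≤-pred (≰⇒> (λ s<k → <⇒≱ (<-≤-trans Nₖ<n (σ-bounded (i , n , Iᵢ≡n)))
                                       (Nseq-mono g-expansive n₀ d s<k)))
    k≤fdim : k ≤ fdim I
    k≤fdim = ≤-trans k≤s (<⇒≤ (toℕ<n (to (i , n , Iᵢ≡n))))
    p : Fin k → FinIdx I
    p y = to⁻ (inject≤ y k≤fdim)
    r : Fin k → Fin d
    r y = proj₁ (p y)
    r-injective : Injective _≡_ _≡_ r
    r-injective {y} {y′} eq = inject≤-injective k≤fdim k≤fdim y y′ (begin
      inject≤ y k≤fdim    ≡⟨ to∘to⁻ _ ⟨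
      to (p y)            ≡⟨ cong to (FinIdx-≡ eq) ⟩
      to (p y′)           ≡⟨ to∘to⁻ _ ⟩
      inject≤ y′ k≤fdim   ∎)
      where open ≡-Reasoning
    r-bounded : ∀ y x → x ∈I I → x (r y) ≤ N k
    r-bounded y x x∈I = begin
      x (r y)                                 ≤⟨ ∈I-fin x∈I (proj₂ (proj₂ (p y))) ⟩
      proj₁ (proj₂ (p y))                     ≤⟨ σ-bounded (p y) ⟩
      N (suc (toℕ (to (p y))))                ≡⟨ cong (λ z → N (suc (toℕ z))) (to∘to⁻ _) ⟩
      N (suc (toℕ (inject≤ y k≤fdim)))        ≡⟨ cong (λ z → N (suc z)) (toℕ-inject≤ y k≤fdim) ⟩
      N (suc (toℕ y))                         ≤⟨ Nseq-mono g-expansive n₀ d (toℕ<n y) ⟩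
      N k                                     ∎
      where open ≤-Reasoning

outside-ideal⇒fin : ∀ {d} {v w : Vecℕ d} {I : Ideal d} {i} →
  w ∈I I → ¬ (v ∈I I) → (∀ j → j ≢ i → v j ≡ w j) → Σ ℕ λ n → I i ≡ fin n
outside-ideal⇒fin {v = v} {I = I} {i} w∈I v∉I agree with I i in Iᵢ≡
... | fin n = n , refl
... | ω     = contradiction v∈I v∉I
  where
  v∈I : v ∈I I
  v∈I j with j ≟F i
  ... | yes refl rewrite Iᵢ≡ = tt
  ... | no j≢i = subst (_≤ω I j) (sym (agree j j≢i)) (w∈I j)

lower : ∀ {d} → Vecℕ d → Fin d → Vecℕ d
lower v i = updateAt v i pred

lower-⊑ : ∀ {d} (v : Vecℕ d) i → lower v i ⊑ v
lower-⊑ v i j with j ≟F i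
... | yes refl = subst (_≤ v i) (sym (updateAt-updates i v)) pred[n]≤n
... | no j≢i  = ≤-reflexive (updateAt-minimal j i v j≢i)

pred-≤-lower : ∀ {d} (v : Vecℕ d) i j → pred (v j) ≤ lower v i j
pred-≤-lower v i j with j ≟F i
... | yes refl = ≤-reflexive (sym (updateAt-updates i v))
... | no j≢i  = subst (pred (v j) ≤_) (sym (updateAt-minimal j i v j≢i)) pred[n]≤n

minimalOutside⇒lower-covered : ∀ {d} {D : Vecℕ d → Set} {Is : List (Ideal d)} →
  (∀ x → D x ⇔ Any (x ∈I_) Is) → ∀ {v} → MinimalOutside D v →
  ∀ i → 0 < v i → Any (lower v i ∈I_) Is
minimalOutside⇒lower-covered {Is = Is} D⇔ {v} (_ , v-minimal) i 0<vᵢ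
  with any? (lower v i ∈I?_) Is
... | yes covered = covered
... | no uncovered = contradiction
        (subst (v i ≤_) (updateAt-updates i v)
          (v-minimal _ (λ D-lower → uncovered (Equivalence.to (D⇔ _) D-lower)) (lower-⊑ v i) i))
        (≰pred 0<vᵢ)
  where
  ≰pred : ∀ {m} → 0 < m → ¬ (m ≤ pred m)
  ≰pred {suc m} _ = 1+n≰n

module _ {g : ℕ → ℕ} (g-expansive : Expansive g) {n₀ d : ℕ}
  {D : Vecℕ d → Set} {Is : List (Ideal d)}
  (D⇔ : ∀ x → D x ⇔ Any (x ∈I_) Is) (thin : All (Thin g n₀) Is)
  {v : Vecℕ d} (v-minimal : MinimalOutside D v) where

  private
    N : ℕ → ℕ
    N = Nseq g n₀ d

  minimalOutside⇒fewerThanAbove : ∀ a k → a + suc k ≡ d →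
    FewerThanAbove (suc a) (N (suc k) + 1) v
  minimalOutside⇒fewerThanAbove a k a+k+1≡d f f-inj above =
    <-irrefl a+k+1≡d (disjoint-injections⇒+≤ f-inj (proj₁ (proj₂ bounded)) f≢r)
    where
    i : Fin d
    i = f fzero
    w : Vecℕ d
    w = lower v i
    above′ : ∀ x → N (suc k) < pred (v (f x))
    above′ x = <⇒≤pred (subst (_< v (f x)) (+-comm (N (suc k)) 1) (above x))
    w-covered : Σ (Ideal d) λ I → I ∈ Is × w ∈I I
    w-covered = find (minimalOutside⇒lower-covered D⇔ v-minimal i
                        (≤pred⇒≤ (≤-<-trans z≤n (above′ fzero))))
    I : Ideal d
    I = proj₁ w-covered
    I∈Is : I ∈ Is
    I∈Is = proj₁ (proj₂ w-covered)
    w∈I : w ∈I I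
    w∈I = proj₂ (proj₂ w-covered)
    v∉I : ¬ (v ∈I I)
    v∉I v∈I = proj₁ v-minimal (Equivalence.from (D⇔ v) (lose I∈Is v∈I))
    Iᵢ-fin : Σ ℕ λ n → I i ≡ fin n
    Iᵢ-fin = outside-ideal⇒fin w∈I v∉I (λ j j≢i → sym (updateAt-minimal j i v j≢i))
    bounded : Σ (Fin (suc k) → Fin d) λ r →
      Injective _≡_ _≡_ r × (∀ y x → x ∈I I → x (r y) ≤ N (suc k))
    bounded = thin⇒bounded-coordinates g-expansive (All.lookup thin I∈Is)
      (suc k) (proj₂ Iᵢ-fin)
      (<-≤-trans (above′ fzero) (≤-trans (pred-≤-lower v i i) (∈I-fin w∈I (proj₂ Iᵢ-fin))))
    r : Fin (suc k) → Fin d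
    r = proj₁ bounded
    f≢r : ∀ x y → f x ≢ r y
    f≢r x y eq = <⇒≱ (<-≤-trans (above′ x) (pred-≤-lower v i (f x)))
      (subst (λ z → w z ≤ N (suc k)) (sym eq) (proj₂ (proj₂ bounded) y w w∈I))

proposition3p8 : (d : ℕ) → 1 ≤ d →
    (g : ℕ → ℕ) → Monotone g → Expansive g → (n₀ : ℕ) →
    (D : Vecℕ d → Set) → DownClosed D →
    (Is : List (Ideal d)) → IsCanonicalDecomposition D Is →
    All (Thin g n₀) Is →
    (v : Vecℕ d) → MinimalOutside D v →
    NearlyThin g n₀ v
proposition3p8 d _ g _ g-expansive n₀ D _ Is (D⇔ , _) thin v v-minimal =
  fewerThanAbove⇒permutation d (λ k → Nseq g n₀ d k + 1) v
    (minimalOutside⇒fewerThanAbove g-expansive D⇔ thin v-minimal)
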